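{- Let $m_1,n_1,m_2,n_2$ be positive integers, let $P$ be a regular partition of $K_{m_1(n_1),m_2(n_2)}$ such that $\tau(P)$ is asymmetric, let $e$ be an edge of $\tau'(P)$, and let $S$ be the set of vertices of $e$ having degree $1$ in $\tau'(P)$. Then $|S| \leq 2^{m_2}$. Moreover, let $j' \ge -1$ and $k'\ge 0$ be the integers with $|S| = \binom{m_2}{0} + \cdots + \binom{m_2}{j'} + k'$ and either $0 \leq k' < \binom{m_2}{j'+1}$, or $k'=0$ and $j' = m_2$ (empty sums are $0$). Then $$w(S) \leq \sum_{i=0}^{j'} (m_2-i)\binom{m_2}{i} + k'(m_2 - j' -1).$$
   Context: $X=K_{m_1(n_1),m_2(n_2)}$ is the complete multipartite graph with parts $A_1,\dots,A_{m_1}$ of size $n_1$ and $B_1,\dots,B_{m_2}$ of size $n_2$. A partition $P$ of $V(X)$ is regular if each part of $P$ meets each $A_i$ and each $B_i$ in at most one vertex. The hypergraph $\tau(P)$ has the parts of $P$ as vertices, the sets $A_1,\dots,A_{m_1},B_1,\dots,B_{m_2}$ as edges, and a part $Q$ incident to an edge $Y$ iff $|Y\cap Q|=1$. A hypergraph automorphism is a pair of permutations of vertices and edges preserving incidence in both directions; asymmetric means only the trivial automorphism exists. The vertex-labelled hypergraph $\tau'(P)$ has the same vertices as $\tau(P)$ but only the edges $A_1,\dots,A_{m_1}$ (with the same incidences); each vertex $Q$ gets the label $L(Q)=\{i\in\{1,\dots,m_2\}: Q \text{ is incident to } B_i \text{ in } \tau(P)\}$. Degrees in $\tau'(P)$ count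 only the edges $A_i$. The weight of a vertex is $w(Q)=|L(Q)|$, and $w(S)=\sum_{Q\in S}w(Q)$. -}

module Defs where

open import Data.Nat using (ℕ; zero; suc; _+_; _*_; _∸_; _≡ᵇ_)
open import Data.Bool using (Bool; true; false; if_then_else_; _∧_)
open import Data.Fin using (Fin; zero; suc; _≟_)
open import Data.Product using (_×_; _,_; ∃)
open import Data.Sum using (_⊎_; inj₁; inj₂)
open import Relation.Nullary.Decidable using (⌊_⌋)
open import Relation.Binary.PropositionalEquality using (_≡_)
open import Function.Bundles using (_↔_; Inverse; _⇔_)
open import Data.Nat.Combinatorics using (_C_)

sumFin : (n : ℕ) → (Fin n → ℕ) → ℕ
sumFin zero    g = 0
sumFin (suc n) g = g zero + sumFin n (λ x → g (suc x))

countFin : (n : ℕ) → (Fin n → Bool) → ℕ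
countFin n b = sumFin n (λ x → if b x then 1 else 0)

-- Vertex set of X = K_{m1(n1),m2(n2)}:  inj₁ (i , a) is the a-th vertex of A_i,
-- inj₂ (j , b) is the b-th vertex of B_j.
Vtx : ℕ → ℕ → ℕ → ℕ → Set
Vtx m₁ n₁ m₂ n₂ = (Fin m₁ × Fin n₁) ⊎ (Fin m₂ × Fin n₂)

-- Edge names of τ(P): inj₁ i stands for A_i, inj₂ j stands for B_j.
Edge : ℕ → ℕ → Set
Edge m₁ m₂ = Fin m₁ ⊎ Fin m₂

module _ {m₁ n₁ m₂ n₂ p : ℕ} (f : Vtx m₁ n₁ m₂ n₂ → Fin p) where

  -- A partition of V(X) into p (nonempty) parts, given by the part-index map f.
  IsPartition : Set
  IsPartition = (q : Fin p) → ∃ λ v → f v ≡ q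

  Regular : Set
  Regular =
    ((i : Fin m₁) (a a′ : Fin n₁) → f (inj₁ (i , a)) ≡ f (inj₁ (i , a′)) → a ≡ a′) ×
    ((j : Fin m₂) (b b′ : Fin n₂) → f (inj₂ (j , b)) ≡ f (inj₂ (j , b′)) → b ≡ b′)

  meet : Edge m₁ m₂ → Fin p → ℕ
  meet (inj₁ i) q = countFin n₁ (λ a → ⌊ f (inj₁ (i , a)) ≟ q ⌋)
  meet (inj₂ j) q = countFin n₂ (λ b → ⌊ f (inj₂ (j , b)) ≟ q ⌋)

  -- incidence in τ(P):  |Y ∩ Q| = 1
  Inc : Fin p → Edge m₁ m₂ → Set
  Inc q e = meet e q ≡ 1

  incᵇ : Fin p → Edge m₁ m₂ → Bool
  incᵇ q e = meet e q ≡ᵇ 1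

  IsAutomorphism : (Fin p ↔ Fin p) → (Edge m₁ m₂ ↔ Edge m₁ m₂) → Set
  IsAutomorphism σ π =
    (q : Fin p) (e : Edge m₁ m₂) → Inc q e ⇔ Inc (Inverse.to σ q) (Inverse.to π e)

  Asymmetric : Set
  Asymmetric = (σ : Fin p ↔ Fin p) (π : Edge m₁ m₂ ↔ Edge m₁ m₂) →
    IsAutomorphism σ π →
    ((q : Fin p) → Inverse.to σ q ≡ q) × ((e : Edge m₁ m₂) → Inverse.to π e ≡ e)

  -- degree of Q in τ′(P) (only edges A_i counted)
  deg′ : Fin p → ℕ
  deg′ q = countFin m₁ (λ i → incᵇ q (inj₁ i))

  weight : Fin p → ℕ
  weight q = countFin m₂ (λ j → incᵇ q (inj₂ j))

  -- S for the edge A_i of τ′(P): vertices of A_i of degree 1 in τ′(P)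
  inS : Fin m₁ → Fin p → Bool
  inS i q = incᵇ q (inj₁ i) ∧ (deg′ q ≡ᵇ 1)

  cardS : Fin m₁ → ℕ
  cardS i = countFin p (inS i)

  weightS : Fin m₁ → ℕ
  weightS i = sumFin p (λ q → if inS i q then weight q else 0)

-- Σ_{i=0}^{t-1} binom(m,i)   (t = j′ + 1)
binomPrefix : ℕ → ℕ → ℕ
binomPrefix m t = sumFin t (λ i → m C Data.Fin.toℕ i)

weightedPrefix : ℕ → ℕ → ℕ
weightedPrefix m t = sumFin t (λ i → (m ∸ Data.Fin.toℕ i) * (m C Data.Fin.toℕ i))

module Submission where

-- Every Q ∈ S is incident, among the A-edges, to A_i only, so two members of S
-- with the same label set L(Q) could be swapped by an automorphism of τ(P);
-- asymmetry therefore makes the labels of S pairwise distinct subsets of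
-- {1,…,m₂}.  Both claims are then facts about a family of distinct subsets of
-- an m-set, with weight = number of elements:
--   * there are at most 2^m of them;
--   * writing c(g) = m − w(g) for the size of the complement, for every t
--       w(g) ≤ (m − t) + (t ∸ c(g)),
--     and the total slack Σ_g (t ∸ c(g)) of distinct subsets is at most
--     layered m t = Σ_{s=1}^{t} Σ_{i<s} C(m,i)  (Pascal induction on m);
--   * (m − t)·Σ_{i<t} C(m,i) + layered m t = Σ_{i<t} (m − i)·C(m,i), which
--     turns these two estimates into the weighted bound of the lemma.

open import Defs
open import Data.Nat using (ℕ; zero; suc; _+_; _*_; _∸_; _≤_; _<_; _^_; NonZero; z≤n; s≤s; _≡ᵇ_; _≤?_)
open import Data.Nat.Properties
open import Data.Nat.Combinatorics using (_C_; nCn≡1; k>n⇒nCk≡0; nCk+nC[k+1]≡[n+1]C[k+1])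
open import Data.Nat.Solver using (module +-*-Solver)
open import Data.Fin using (Fin; zero; suc; toℕ)
import Data.Fin as Fin
import Data.Fin.Properties as Fin
import Data.Fin.Permutation as Perm
import Data.Fin.Permutation.Components as PermC
open import Data.Product using (_×_; _,_; proj₁)
open import Data.Sum using (_⊎_; inj₁; inj₂)
open import Data.Bool using (Bool; true; false; if_then_else_; _∧_; not; T)
open import Data.Bool.Properties using (not-¬; ¬-not)
import Data.Bool as Bool
open import Data.List using (List; []; _∷_)
open import Data.List.Relation.Unary.All using (All; []; _∷_)
open import Data.List.Relation.Unary.AllPairs using (AllPairs; []; _∷_)
open import Data.Empty using (⊥-elim)
open import Data.Unit using (tt)
open import Function using (_∘_)
open import Function.Bundles using (_⇔_; mk⇔)
open import Function.Construct.Identity using (↔-id; ⇔-id)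
open import Relation.Nullary using (¬_; yes; no; does)
open import Relation.Nullary.Decidable using (dec-true)
open import Relation.Binary.PropositionalEquality
  using (_≡_; refl; sym; trans; cong; cong₂; subst; module ≡-Reasoning)
open import Algebra.Properties.CommutativeSemigroup +-commutativeSemigroup using (x∙yz≈y∙xz)

open +-*-Solver using (solve; _:+_; _:*_; _:=_; con)

-- Binomial sums

sumBelow : ℕ → (ℕ → ℕ) → ℕ
sumBelow zero    g = 0
sumBelow (suc t) g = sumBelow t g + g t

sumBelow-suc : ∀ t g → sumBelow (suc t) g ≡ g 0 + sumBelow t (g ∘ suc)
sumBelow-suc zero    g = +-comm 0 (g 0)
sumBelow-suc (suc t) g = begin
  sumBelow t g + g t + g (suc t)             ≡⟨ cong (_+ g (suc t)) (sumBelow-suc t g) ⟩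
  g 0 + sumBelow t (g ∘ suc) + g (suc t)     ≡⟨ +-assoc (g 0) _ _ ⟩
  g 0 + (sumBelow t (g ∘ suc) + g (suc t))   ∎
  where open ≡-Reasoning

sumFin≡sumBelow : ∀ t g → sumFin t (g ∘ toℕ) ≡ sumBelow t g
sumFin≡sumBelow zero    g = refl
sumFin≡sumBelow (suc t) g =
  trans (cong (g 0 +_) (sumFin≡sumBelow t (g ∘ suc))) (sym (sumBelow-suc t g))

-- prefix m t = Σ_{i<t} C(m,i), the number of subsets of an m-set of size < t.
prefix : ℕ → ℕ → ℕ
prefix m t = sumBelow t (m C_)

weighted : ℕ → ℕ → ℕ
weighted m t = sumBelow t (λ i → (m ∸ i) * (m C i))

-- layered m t = Σ_{s=1}^{t} prefix m s = Σ_{c<t} (t − c)·C(m,c): the largest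
-- possible total slack Σ (t ∸ |complement|) of distinct subsets of an m-set.
layered : ℕ → ℕ → ℕ
layered m zero    = 0
layered m (suc t) = layered m t + prefix m (suc t)

prefix-pascal : ∀ m r → prefix (suc m) (suc r) ≡ prefix m (suc r) + prefix m r
prefix-pascal m zero    = refl
prefix-pascal m (suc r) = begin
  prefix (suc m) (suc r) + suc m C suc r
    ≡⟨ cong₂ _+_ (prefix-pascal m r) (sym (nCk+nC[k+1]≡[n+1]C[k+1] m r)) ⟩
  (prefix m (suc r) + prefix m r) + (m C r + m C suc r)
    ≡⟨ solve 4 (λ a b c d → (a :+ b) :+ (c :+ d) := (a :+ d) :+ (b :+ c))
             refl (prefix m (suc r)) (prefix m r) (m C r) (m C suc r) ⟩
  (prefix m (suc r) + m C suc r) + (prefix m r + m C r)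
    ∎
  where open ≡-Reasoning

-- Pascal's rule, summed twice: the recursion matching a split of the subsets
-- according to whether they contain the first element.
layered-pascal : ∀ m t → layered (suc m) t ≡ layered m t + layered m (t ∸ 1)
layered-pascal m zero    = refl
layered-pascal m (suc t) = begin
  layered (suc m) t + prefix (suc m) (suc t)
    ≡⟨ cong₂ _+_ (layered-pascal m t) (prefix-pascal m t) ⟩
  (layered m t + layered m (t ∸ 1)) + (prefix m (suc t) + prefix m t)
    ≡⟨ solve 4 (λ a b c d → (a :+ b) :+ (c :+ d) := (a :+ c) :+ (b :+ d))
             refl (layered m t) (layered m (t ∸ 1)) (prefix m (suc t)) (prefix m t) ⟩
  layered m (suc t) + (layered m (t ∸ 1) + prefix m t)
    ≡⟨ cong (layered m (suc t) +_) (layered-step t) ⟩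
  layered m (suc t) + layered m t
    ∎
  where
  open ≡-Reasoning
  layered-step : ∀ s → layered m (s ∸ 1) + prefix m s ≡ layered m s
  layered-step zero    = refl
  layered-step (suc s) = refl

-- Over the empty ground set only the empty subset exists.
prefix-zero : ∀ r → prefix 0 (suc r) ≡ 1
prefix-zero zero    = refl
prefix-zero (suc r) = cong₂ _+_ (prefix-zero r) (k>n⇒nCk≡0 {n = 0} {k = suc r} (s≤s z≤n))

layered-zero : ∀ t → layered 0 t ≡ t
layered-zero zero    = refl
layered-zero (suc t) = trans (cong₂ _+_ (layered-zero t) (prefix-zero t)) (+-comm t 1)

weighted≡ : ∀ m t → t ≤ m → (m ∸ t) * prefix m t + layered m t ≡ weighted m t
weighted≡ m zero    _    = trans (+-identityʳ (m * 0)) (*-zeroʳ m)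
weighted≡ m (suc t) t<m = begin
  (m ∸ suc t) * (P + c) + (layered m t + (P + c))
    ≡⟨ solve 4 (λ d p h c → d :* (p :+ c) :+ (h :+ (p :+ c))
                          := ((con 1 :+ d) :* p :+ h) :+ (con 1 :+ d) :* c)
             refl (m ∸ suc t) P (layered m t) c ⟩
  (suc (m ∸ suc t) * P + layered m t) + suc (m ∸ suc t) * c
    ≡⟨ cong (λ d → (d * P + layered m t) + d * c) (sym (+-∸-assoc 1 t<m)) ⟩
  ((m ∸ t) * P + layered m t) + (m ∸ t) * c
    ≡⟨ cong (_+ (m ∸ t) * c) (weighted≡ m t (<⇒≤ t<m)) ⟩
  weighted m t + (m ∸ t) * c
    ∎
  where
  open ≡-Reasoning
  P c : ℕ
  P = prefix m t
  c = m C t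

-- The last binomial coefficient C(m,m) = 1 carries no weight.
prefix-top : ∀ m → prefix m (suc m) ≡ prefix m m + 1
prefix-top m = cong (prefix m m +_) (nCn≡1 m)

weighted-top : ∀ m → weighted m (suc m) ≡ weighted m m
weighted-top m = begin
  weighted m m + (m ∸ m) * (m C m)   ≡⟨ cong (λ d → weighted m m + d * (m C m)) (n∸n≡0 m) ⟩
  weighted m m + 0                   ≡⟨ +-identityʳ _ ⟩
  weighted m m                       ∎
  where open ≡-Reasoning

-- Families of distinct labels

-- A label is a subset of Fin m; its weight is countFin m, its co-weight the
-- size of its complement.
Label : ℕ → Set
Label m = Fin m → Bool

_≈_ : ∀ {m} → Label m → Label m → Set
g ≈ h = ∀ j → g j ≡ h j

Distinct : ∀ {m} → List (Label m) → Set
Distinct = AllPairs (λ g h → ¬ g ≈ h)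

coweight : (m : ℕ) → Label m → ℕ
coweight m g = countFin m (not ∘ g)

weight+coweight : ∀ m (g : Label m) → countFin m g + coweight m g ≡ m
weight+coweight zero    g = refl
weight+coweight (suc m) g with g zero
... | true  = cong suc (weight+coweight m (g ∘ suc))
... | false = trans (+-suc _ _) (cong suc (weight+coweight m (g ∘ suc)))

weight≤ : ∀ m t (g : Label m) → countFin m g ≤ (m ∸ t) + (t ∸ coweight m g)
weight≤ m t g = begin
  w                          ≡⟨ sym (m+n∸n≡m w c) ⟩
  w + c ∸ c                  ≡⟨ cong (_∸ c) (weight+coweight m g) ⟩
  m ∸ c                      ≤⟨ m≤n+o⇒m∸n≤o m c m≤ ⟩
  (m ∸ t) + (t ∸ c)          ∎
  where
  open ≤-Reasoning
  w c : ℕ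
  w = countFin m g
  c = coweight m g
  m≤ : m ≤ c + ((m ∸ t) + (t ∸ c))
  m≤ = begin
    m                        ≤⟨ m≤n+m∸n m t ⟩
    t + (m ∸ t)              ≤⟨ +-monoˡ-≤ (m ∸ t) (m≤n+m∸n t c) ⟩
    c + (t ∸ c) + (m ∸ t)    ≡⟨ solve 3 (λ c s d → c :+ s :+ d := c :+ (d :+ s)) refl c (t ∸ c) (m ∸ t) ⟩
    c + ((m ∸ t) + (t ∸ c))  ∎

total : ∀ {A : Set} → (A → ℕ) → List A → ℕ
total w []       = 0
total w (x ∷ xs) = w x + total w xs

size : ∀ {A : Set} → List A → ℕ
size = total (λ _ → 1)

total-mono : ∀ {A : Set} {u v : A → ℕ} (xs : List A) → (∀ x → u x ≤ v x) → total u xs ≤ total v xs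
total-mono []       u≤v = z≤n
total-mono (x ∷ xs) u≤v = +-mono-≤ (u≤v x) (total-mono xs u≤v)

total-+const : ∀ {A : Set} a (v : A → ℕ) (xs : List A) → total (λ x → a + v x) xs ≡ a * size xs + total v xs
total-+const a v []       = sym (trans (+-identityʳ (a * 0)) (*-zeroʳ a))
total-+const a v (x ∷ xs) = begin
  a + v x + total (λ x → a + v x) xs     ≡⟨ cong (a + v x +_) (total-+const a v xs) ⟩
  a + v x + (a * size xs + total v xs)   ≡⟨ solve 4 (λ a b n s → a :+ b :+ (a :* n :+ s) := a :* (con 1 :+ n) :+ (b :+ s))
                                                  refl a (v x) (size xs) (total v xs) ⟩
  a * size (x ∷ xs) + (v x + total v xs) ∎
  where open ≡-Reasoning

branch : ∀ {m} → Bool → List (Label (suc m)) → List (Label m)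
branch b []       = []
branch b (g ∷ xs) = if does (g zero Bool.≟ b) then g ∘ suc ∷ branch b xs else branch b xs

total-branch : ∀ {m} (w : Bool → Label m → ℕ) (xs : List (Label (suc m))) →
  total (λ g → w (g zero) (g ∘ suc)) xs ≡ total (w true) (branch true xs) + total (w false) (branch false xs)
total-branch w []       = refl
total-branch w (g ∷ xs) with g zero
... | true  = trans (cong (w true  (g ∘ suc) +_) (total-branch w xs))
                    (sym (+-assoc (w true (g ∘ suc)) (total (w true) (branch true xs)) (total (w false) (branch false xs))))
... | false = trans (cong (w false (g ∘ suc) +_) (total-branch w xs))
                    (x∙yz≈y∙xz (w false (g ∘ suc)) (total (w true) (branch true xs)) (total (w false) (branch false xs)))

≈-cons : ∀ {m} {g h : Label (suc m)} → g zero ≡ h zero → (g ∘ suc) ≈ (h ∘ suc) → g ≈ h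
≈-cons e₀ _  zero    = e₀
≈-cons _  eₛ (suc j) = eₛ j

distinct-branch : ∀ {m} b (xs : List (Label (suc m))) → Distinct xs → Distinct (branch b xs)
distinct-branch b []       []                = []
distinct-branch b (g ∷ xs) (g≉xs ∷ distinct) with g zero Bool.≟ b
... | yes g₀≡b = apart xs g≉xs ∷ distinct-branch b xs distinct
  where
  apart : ∀ ys → All (λ h → ¬ g ≈ h) ys → All (λ h → ¬ (g ∘ suc) ≈ h) (branch b ys)
  apart []       []            = []
  apart (h ∷ ys) (g≉h ∷ g≉ys) with h zero Bool.≟ b
  ... | yes h₀≡b = (λ gₛ≈hₛ → g≉h (≈-cons (trans g₀≡b (sym h₀≡b)) gₛ≈hₛ)) ∷ apart ys g≉ys
  ... | no  _    = apart ys g≉ys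
... | no  _    = distinct-branch b xs distinct

distinct-size : ∀ m (xs : List (Label m)) → Distinct xs → size xs ≤ 2 ^ m
distinct-size zero    []          _                  = z≤n
distinct-size zero    (_ ∷ [])    _                  = s≤s z≤n
distinct-size zero    (g ∷ h ∷ _) ((g≉h ∷ _) ∷ _)    = ⊥-elim (g≉h (λ ()))
distinct-size (suc m) xs          distinct           = begin
  size xs                                          ≡⟨ total-branch (λ _ _ → 1) xs ⟩
  size (branch true xs) + size (branch false xs)   ≤⟨ +-mono-≤ (distinct-size m _ (distinct-branch true xs distinct))
                                                               (distinct-size m _ (distinct-branch false xs distinct)) ⟩
  2 ^ m + 2 ^ m                                    ≡⟨ cong (2 ^ m +_) (sym (+-identityʳ (2 ^ m))) ⟩
  2 ^ suc m                                        ∎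
  where open ≤-Reasoning

distinct-slack : ∀ m t (xs : List (Label m)) → Distinct xs → total (λ g → t ∸ coweight m g) xs ≤ layered m t
distinct-slack zero    t []          _               = z≤n
distinct-slack zero    t (_ ∷ [])    _               = ≤-reflexive (trans (+-identityʳ t) (sym (layered-zero t)))
distinct-slack zero    t (g ∷ h ∷ _) ((g≉h ∷ _) ∷ _) = ⊥-elim (g≉h (λ ()))
distinct-slack (suc m) t xs          distinct        = begin
  total (λ g → t ∸ coweight (suc m) g) xs
    ≡⟨ total-branch (λ b g → t ∸ ((if not b then 1 else 0) + coweight m g)) xs ⟩
  total (λ g → t ∸ coweight m g) (branch true xs) + total (λ g → t ∸ suc (coweight m g)) (branch false xs)
    ≤⟨ +-monoʳ-≤ _ (total-mono (branch false xs) (λ g → ≤-reflexive (sym (∸-+-assoc t 1 (coweight m g))))) ⟩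
  total (λ g → t ∸ coweight m g) (branch true xs) + total (λ g → t ∸ 1 ∸ coweight m g) (branch false xs)
    ≤⟨ +-mono-≤ (distinct-slack m t _ (distinct-branch true xs distinct))
                (distinct-slack m (t ∸ 1) _ (distinct-branch false xs distinct)) ⟩
  layered m t + layered m (t ∸ 1)
    ≡⟨ sym (layered-pascal m t) ⟩
  layered (suc m) t
    ∎
  where open ≤-Reasoning

distinct-weight : ∀ m t (xs : List (Label m)) → Distinct xs →
  total (countFin m) xs ≤ (m ∸ t) * size xs + layered m t
distinct-weight m t xs distinct = begin
  total (countFin m) xs                             ≤⟨ total-mono xs (weight≤ m t) ⟩
  total (λ g → (m ∸ t) + (t ∸ coweight m g)) xs     ≡⟨ total-+const (m ∸ t) _ xs ⟩
  (m ∸ t) * size xs + total (λ g → t ∸ coweight m g) xs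
                                                    ≤⟨ +-monoʳ-≤ _ (distinct-slack m t xs distinct) ⟩
  (m ∸ t) * size xs + layered m t                   ∎
  where open ≤-Reasoning

distinct-weight-prefix : ∀ m t k (xs : List (Label m)) → Distinct xs → t ≤ m →
  size xs ≡ prefix m t + k → total (countFin m) xs ≤ weighted m t + k * (m ∸ t)
distinct-weight-prefix m t k xs distinct t≤m |xs| = begin
  total (countFin m) xs                          ≤⟨ distinct-weight m t xs distinct ⟩
  (m ∸ t) * size xs + layered m t                ≡⟨ cong (λ n → (m ∸ t) * n + layered m t) |xs| ⟩
  (m ∸ t) * (prefix m t + k) + layered m t       ≡⟨ solve 4 (λ d p k l → d :* (p :+ k) :+ l := (d :* p :+ l) :+ k :* d)
                                                         refl (m ∸ t) (prefix m t) k (layered m t) ⟩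
  (m ∸ t) * prefix m t + layered m t + k * (m ∸ t) ≡⟨ cong (_+ k * (m ∸ t)) (weighted≡ m t t≤m) ⟩
  weighted m t + k * (m ∸ t)                     ∎
  where open ≤-Reasoning

-- The weighted bound in the notation of the statement.  For t > m the
-- alternative k < C(m,t) = 0 is void, so |xs| = 2^m = prefix m m + 1 and the
-- case t = m, k = 1 applies.
distinct-bound : ∀ m t k (xs : List (Label m)) → Distinct xs →
  size xs ≡ binomPrefix m t + k → (k < m C t ⊎ (k ≡ 0 × t ≡ suc m)) →
  total (countFin m) xs ≤ weightedPrefix m t + k * (m ∸ t)
distinct-bound m t k xs distinct |xs| range with t ≤? m
... | yes t≤m = subst (λ W → total (countFin m) xs ≤ W + k * (m ∸ t)) (sym (sumFin≡sumBelow t _))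
                  (distinct-weight-prefix m t k xs distinct t≤m (trans |xs| (cong (_+ k) (sumFin≡sumBelow t _))))
... | no  t≰m with range
...   | inj₁ k<C = ⊥-elim (n≮0 (subst (k <_) (k>n⇒nCk≡0 (≰⇒> t≰m)) k<C))
...   | inj₂ (refl , refl) = begin
  total (countFin m) xs                   ≤⟨ distinct-weight-prefix m m 1 xs distinct ≤-refl size≡ ⟩
  weighted m m + 1 * (m ∸ m)              ≡⟨ cong (weighted m m +_) (trans (*-identityˡ _) (n∸n≡0 m)) ⟩
  weighted m m + 0                        ≡⟨ cong (_+ 0) (sym (trans (sumFin≡sumBelow (suc m) _) (weighted-top m))) ⟩
  weightedPrefix m (suc m) + 0            ∎
  where
  open ≤-Reasoning
  size≡ : size xs ≡ prefix m m + 1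
  size≡ = trans |xs| (trans (+-identityʳ _) (trans (sumFin≡sumBelow (suc m) _) (prefix-top m)))

select : ∀ {A : Set} (p : ℕ) → (Fin p → Bool) → (Fin p → A) → List A
select zero    b L = []
select (suc p) b L =
  if b zero then L zero ∷ select p (b ∘ suc) (L ∘ suc) else select p (b ∘ suc) (L ∘ suc)

total-select : ∀ {A : Set} p (b : Fin p → Bool) (L : Fin p → A) (w : A → ℕ) →
  sumFin p (λ q → if b q then w (L q) else 0) ≡ total w (select p b L)
total-select zero    b L w = refl
total-select (suc p) b L w with b zero
... | true  = cong (w (L zero) +_) (total-select p (b ∘ suc) (L ∘ suc) w)
... | false = total-select p (b ∘ suc) (L ∘ suc) w

distinct-select : ∀ {m} p (b : Fin p → Bool) (L : Fin p → Label m) →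
  (∀ q q′ → b q ≡ true → b q′ ≡ true → L q ≈ L q′ → q ≡ q′) → Distinct (select p b L)
distinct-select zero    b L separates = []
distinct-select {m} (suc p) b L separates with b zero in b₀
... | true  = apart p (b ∘ suc) (L ∘ suc) (λ q b-q L₀≈L-q → Fin.0≢1+n (separates zero (suc q) b₀ b-q L₀≈L-q))
            ∷ distinct-select p (b ∘ suc) (L ∘ suc) separates-suc
  where
  separates-suc : ∀ q q′ → b (suc q) ≡ true → b (suc q′) ≡ true → L (suc q) ≈ L (suc q′) → q ≡ q′
  separates-suc q q′ b-q b-q′ L≈ = Fin.suc-injective (separates (suc q) (suc q′) b-q b-q′ L≈)
  apart : ∀ r (c : Fin r → Bool) (K : Fin r → Label m) → (∀ q → c q ≡ true → ¬ L zero ≈ K q) →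
          All (λ h → ¬ L zero ≈ h) (select r c K)
  apart zero    c K _   = []
  apart (suc r) c K sep with c zero in c₀
  ... | true  = sep zero c₀ ∷ apart r (c ∘ suc) (K ∘ suc) (sep ∘ suc)
  ... | false = apart r (c ∘ suc) (K ∘ suc) (sep ∘ suc)
... | false = distinct-select p (b ∘ suc) (L ∘ suc)
                (λ q q′ b-q b-q′ L≈ → Fin.suc-injective (separates (suc q) (suc q′) b-q b-q′ L≈))

count-pos : ∀ n (b : Fin n → Bool) j → b j ≡ true → 0 < countFin n b
count-pos (suc n) b zero    b-j rewrite b-j = s≤s z≤n
count-pos (suc n) b (suc j) b-j = ≤-trans (count-pos n (b ∘ suc) j b-j) (m≤n+m _ _)

count-one-unique : ∀ n (b : Fin n → Bool) → countFin n b ≡ 1 →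
  ∀ i j → b i ≡ true → b j ≡ true → i ≡ j
count-one-unique (suc n) b one i j b-i b-j with b zero in b₀
... | true  = trans (at-zero i b-i) (sym (at-zero j b-j))
  where
  at-zero : ∀ k → b k ≡ true → k ≡ zero
  at-zero zero    _   = refl
  at-zero (suc k) b-k = ⊥-elim (n≮0 (subst (0 <_) (suc-injective one) (count-pos n (b ∘ suc) k b-k)))
... | false = off-zero i j b-i b-j
  where
  off-zero : ∀ i j → b i ≡ true → b j ≡ true → i ≡ j
  off-zero zero    _       b-i _   = ⊥-elim (not-¬ b-i b₀)
  off-zero (suc _) zero    _   b-j = ⊥-elim (not-¬ b-j b₀)
  off-zero (suc i) (suc j) b-i b-j = cong suc (count-one-unique n (b ∘ suc) one i j b-i b-j)

≡ᵇ-true : ∀ a b → (a ≡ᵇ b) ≡ true → a ≡ b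
≡ᵇ-true a b e = ≡ᵇ⇒≡ a b (subst T (sym e) tt)

∧-true : ∀ x y → x ∧ y ≡ true → x ≡ true × y ≡ true
∧-true true true refl = refl , refl

≡1-cong : ∀ a b → (a ≡ᵇ 1) ≡ (b ≡ᵇ 1) → (a ≡ 1) ⇔ (b ≡ 1)
≡1-cong a b e = mk⇔ (λ a≡1 → ≡ᵇ-true b 1 (trans (sym e) (≡⇒≡ᵇ-true a≡1)))
                    (λ b≡1 → ≡ᵇ-true a 1 (trans e (≡⇒≡ᵇ-true b≡1)))
  where
  ≡⇒≡ᵇ-true : ∀ {c} → c ≡ 1 → (c ≡ᵇ 1) ≡ true
  ≡⇒≡ᵇ-true refl = refl

-- Asymmetry separates the labels of S

module Labels {m₁ n₁ m₂ n₂ p : ℕ} (f : Vtx m₁ n₁ m₂ n₂ → Fin p) where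

  label : Fin p → Label m₂
  label q j = incᵇ f q (inj₂ j)

  S-incidence : ∀ i q → inS f i q ≡ true → ∀ i′ → incᵇ f q (inj₁ i′) ≡ does (i′ Fin.≟ i)
  S-incidence i q q∈S i′ with ∧-true (incᵇ f q (inj₁ i)) (deg′ f q ≡ᵇ 1) q∈S | i′ Fin.≟ i
  ... | q∼Aᵢ , _      | yes refl = q∼Aᵢ
  ... | q∼Aᵢ , degree | no  i′≢i = ¬-not λ q∼Aᵢ′ →
    i′≢i (count-one-unique m₁ (λ k → incᵇ f q (inj₁ k)) (≡ᵇ-true (deg′ f q) 1 degree) i′ i q∼Aᵢ′ q∼Aᵢ)

  same-incidence : ∀ i q q′ → inS f i q ≡ true → inS f i q′ ≡ true → label q ≈ label q′ →
    ∀ e → incᵇ f q e ≡ incᵇ f q′ e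
  same-incidence i q q′ q∈S q′∈S _     (inj₁ i′) = trans (S-incidence i q q∈S i′) (sym (S-incidence i q′ q′∈S i′))
  same-incidence i q q′ q∈S q′∈S L≈L′ (inj₂ j)  = L≈L′ j

  swap-automorphism : ∀ i q q′ → inS f i q ≡ true → inS f i q′ ≡ true → label q ≈ label q′ →
    IsAutomorphism f (Perm.transpose q q′) (↔-id (Edge m₁ m₂))
  swap-automorphism i q q′ q∈S q′∈S L≈L′ x e with x Fin.≟ q
  ... | yes refl = ≡1-cong (meet f e x) (meet f e q′) (same-incidence i q q′ q∈S q′∈S L≈L′ e)
  ... | no  _ with x Fin.≟ q′
  ...   | yes refl = ≡1-cong (meet f e x) (meet f e q) (sym (same-incidence i q q′ q∈S q′∈S L≈L′ e))
  ...   | no  _    = ⇔-id _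

  -- In an asymmetric τ(P) that swap is trivial, so the labels on S are distinct.
  labels-distinct : Asymmetric f → ∀ i → Distinct (select p (inS f i) label)
  labels-distinct asymmetric i = distinct-select p (inS f i) label λ q q′ q∈S q′∈S L≈L′ →
    trans (sym (proj₁ (asymmetric (Perm.transpose q q′) (↔-id (Edge m₁ m₂)) (swap-automorphism i q q′ q∈S q′∈S L≈L′)) q)) (swapped q q′)
    where
    swapped : ∀ q q′ → PermC.transpose q q′ q ≡ q′
    swapped q q′ rewrite dec-true (q Fin.≟ q) refl = refl

lemma4p2 : (m₁ n₁ m₂ n₂ : ℕ) → .{{NonZero m₁}} → .{{NonZero n₁}} → .{{NonZero m₂}} → .{{NonZero n₂}} →
    (p : ℕ) (f : Vtx m₁ n₁ m₂ n₂ → Fin p) →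
    IsPartition f → Regular f → Asymmetric f →
    (i : Fin m₁) →
    (cardS f i ≤ 2 ^ m₂) ×
    ((t k′ : ℕ) →
      cardS f i ≡ binomPrefix m₂ t + k′ →
      (k′ < m₂ C t ⊎ (k′ ≡ 0 × t ≡ suc m₂)) →
      weightS f i ≤ weightedPrefix m₂ t + k′ * (m₂ ∸ t))
lemma4p2 m₁ n₁ m₂ n₂ p f _ _ asymmetric i =
  subst (_≤ 2 ^ m₂) (sym |S|≡) (distinct-size m₂ labelsS distinct) ,
  λ t k′ |S|-split k′-range →
    subst (_≤ weightedPrefix m₂ t + k′ * (m₂ ∸ t)) (sym w[S]≡)
      (distinct-bound m₂ t k′ labelsS distinct (trans (sym |S|≡) |S|-split) k′-range)
  where
  open Labels f
  labelsS : List (Label m₂)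
  labelsS = select p (inS f i) label
  distinct : Distinct labelsS
  distinct = labels-distinct asymmetric i
  |S|≡ : cardS f i ≡ size labelsS
  |S|≡ = total-select p (inS f i) label (λ _ → 1)
  w[S]≡ : weightS f i ≡ total (countFin m₂) labelsS
  w[S]≡ = total-select p (inS f i) label (countFin m₂)
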